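{- Let $(X^{\mathrm{in}},X^0,\{X^i\}_{i\in\mathcal I},\{T^i\}_{i\in\mathcal I})$ be a constrained piecewise polynomial discrete-time system as described in the context, with reachable set $\mathfrak R$. Let $\kappa\in\mathbb R[x]$ and $\alpha\in\mathbb R\cup\{+\infty\}$. Let $(p,w)\in\mathbb R[x]\times\mathbb R$ satisfy \begin{itemize} \item $p(x)\le 0$ for all $x\in X^{\mathrm{in}}$; \item for every $i\in\mathcal I$, $p(T^i(x))\le p(x)$ for all $x\in X^i\cap X^0$; \item $\kappa(x)\le w+p(x)$ for all $x\in\mathbb R^d$, \end{itemize} and suppose $w\le\alpha$ (when $\alpha\in\mathbb R$; when $\alpha=+\infty$ this is just $w<+\infty$). Let $P:=\{x\in\mathbb R^d\mid p(x)\le 0\}$. Then: (1) $p(x)\le 0$ for all $x\in X^{\mathrm{in}}$, and for every $i\in\mathcal I$, $p(T^i(x))\le 0$ for all $x\in P\cap X^i\cap X^0$ (so $P$ is an inductive invariant); (2) $\kappa(x)\le w\le\alpha$ for all $x\in P$; (3) $\mathfrak R\subseteq P\subseteq \mathcal P_{\kappa,w}\subseteq\mathcal P_{\kappa,\alpha}$.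
   Context: $\mathbb R[x]$ denotes real polynomials in $x=(x_1,\dots,x_d)$. A basic semialgebraic set is a set $\{x\in\mathbb R^d\mid g_j(x)\ll 0,\ j=1,\dots,m\}$ with $g_j\in\mathbb R[x]$, where each $\ll$ is either $\le$ or $<$. A constrained piecewise polynomial discrete-time system (PPS) is a quadruple $(X^{\mathrm{in}},X^0,\{X^i\}_{i\in\mathcal I},\{T^i\}_{i\in\mathcal I})$ where $X^{\mathrm{in}}\subseteq\mathbb R^d$ is a compact basic semialgebraic set (initial conditions), $X^0\subseteq\mathbb R^d$ is a basic semialgebraic set (loop condition), $\mathcal I$ is finite, $\{X^i\}_{i\in\mathcal I}$ is a partition of $\mathbb R^d$ into nonempty basic semialgebraic sets, and each $T^i:\mathbb R^d\to\mathbb R^d$ is polynomial. Its dynamics: $x_0\in X^{\mathrm{in}}$, and if $x_k\in X^i\cap X^0$ then $x_{k+1}=T^i(x_k)$; if $x_k\notin X^0$ the system stops. The reachable set $\mathfrak R$ is the set of all states $x_k$ occurring in such runs; equivalently, it is the smallest set $C\subseteq\mathbb R^d$ with $X^{\mathrm{in}}\cup\bigcup_{i\in\mathcal I}T^i(C\cap X^i\cap X^0)\subseteq C$. A set $C$ satisfying this inclusion is called an inductive invariant. For $\kappa\in\mathbb R[x]$ and $\alpha\in\mathbb R$, $\mathcal P_{\kappa,\alpha}:=\{x\in\mathbb R^d\mid\kappa(x)\le\alpha\}$; for $\alpha=+\infty$, $\mathcal P_{\kappa,+\infty}:=\{x\mid \kappa(x)<+\infty\}=\mathbb R^d$. -}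

module Defs where

open import Data.Nat using (ℕ)
open import Data.Fin using (Fin)
open import Data.Bool using (Bool; true; false)
open import Data.List using (List)
open import Data.List.Relation.Unary.All using (All)
open import Data.Maybe using (Maybe; just; nothing)
open import Data.Product using (Σ; ∃; _×_; _,_)
open import Data.Unit using (⊤)
open import Relation.Nullary using (¬_)
open import Relation.Binary.PropositionalEquality using (_≡_; _≢_)
open import Algebra.Structures using (IsCommutativeRing)
open import Relation.Binary.Structures using (IsTotalOrder)

-- The real numbers, given axiomatically as a Dedekind-complete ordered
-- field (agda-stdlib has no reals).  All statements are quantified over
-- an arbitrary such structure (which is unique up to isomorphism).

record RealField : Set₁ where
  infixl 6 _+_
  infixl 7 _*_
  infix 4 _≤_
  field
    R   : Set
    0# 1# : R
    _+_ _*_ : R → R → R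
    -_  : R → R
    _≤_ : R → R → Set
    isCommutativeRing : IsCommutativeRing _≡_ _+_ _*_ -_ 0# 1#
    0≢1 : 0# ≢ 1#
    inverse : ∀ x → x ≢ 0# → Σ R λ y → x * y ≡ 1#
    isTotalOrder : IsTotalOrder _≡_ _≤_
    +-mono-≤ : ∀ x y z → x ≤ y → x + z ≤ y + z
    *-nonneg : ∀ x y → 0# ≤ x → 0# ≤ y → 0# ≤ x * y
    complete : (S : R → Set) → (Σ R S) → (Σ R λ b → ∀ x → S x → x ≤ b) →
               Σ R λ s → (∀ x → S x → x ≤ s) × (∀ b → (∀ x → S x → x ≤ b) → s ≤ b)

module _ (ℝ : RealField) where
  open RealField ℝ

  _<_ : R → R → Set
  x < y = (x ≤ y) × (x ≢ y)

  Point : ℕ → Set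
  Point d = Fin d → R

  data Poly (d : ℕ) : Set where
    const : R → Poly d
    var   : Fin d → Poly d
    _⊕_   : Poly d → Poly d → Poly d
    _⊗_   : Poly d → Poly d → Poly d

  eval : ∀ {d} → Poly d → Point d → R
  eval (const c) x = c
  eval (var j) x = x j
  eval (p ⊕ q) x = eval p x + eval q x
  eval (p ⊗ q) x = eval p x * eval q x

  PolyMap : ℕ → Set
  PolyMap d = Fin d → Poly d

  evalMap : ∀ {d} → PolyMap d → Point d → Point d
  evalMap T x j = eval (T j) x

  -- basic semialgebraic sets: list of constraints g ≪ 0, flag true means '<'
  BSA : ℕ → Set
  BSA d = List (Poly d × Bool)

  holds : ∀ {d} → Poly d × Bool → Point d → Set
  holds (g , true)  x = eval g x < 0#
  holds (g , false) x = eval g x ≤ 0#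

  _∈B_ : ∀ {d} → Point d → BSA d → Set
  x ∈B S = All (λ c → holds c x) S

  -- topology of ℝ^d (sup-norm), compactness = closed and bounded
  Bounded : ∀ {d} → (Point d → Set) → Set
  Bounded {d} S = Σ R λ M → ∀ x → S x → ∀ j → (- M ≤ x j) × (x j ≤ M)

  ConvergesTo : ∀ {d} → (ℕ → Point d) → Point d → Set
  ConvergesTo s x = ∀ ε → 0# < ε → Σ ℕ λ N → ∀ k → N Data.Nat.≤ k →
                      ∀ j → (- ε ≤ s k j + - x j) × (s k j + - x j ≤ ε)

  Closed : ∀ {d} → (Point d → Set) → Set
  Closed S = ∀ s x → (∀ k → S (s k)) → ConvergesTo s x → S x

  Compact : ∀ {d} → (Point d → Set) → Set
  Compact S = Closed S × Bounded S

  record PPS (d : ℕ) : Set where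
    field
      Xin : BSA d
      X0  : BSA d
      n   : ℕ
      X   : Fin n → BSA d
      T   : Fin n → PolyMap d
      Xin-compact : Compact (λ x → x ∈B Xin)
      partition : ∀ x → Σ (Fin n) λ i → (x ∈B X i) × (∀ k → x ∈B X k → k ≡ i)
      nonempty  : ∀ i → Σ (Point d) λ x → x ∈B X i

  module _ {d : ℕ} (S : PPS d) where
    open PPS S

    data Reach : Point d → Set where
      init : ∀ {x} → x ∈B Xin → Reach x
      step : ∀ {x} i → Reach x → x ∈B X i → x ∈B X0 → Reach (evalMap (T i) x)

    IsInductiveInvariant : (Point d → Set) → Set
    IsInductiveInvariant C = (∀ x → x ∈B Xin → C x) ×
      (∀ i x → C x → x ∈B X i → x ∈B X0 → C (evalMap (T i) x))

  -- ℝ ∪ {+∞} as Maybe R (nothing = +∞)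
  _≤∞_ : R → Maybe R → Set
  w ≤∞ nothing = ⊤
  w ≤∞ just a = w ≤ a

  Pκ : ∀ {d} → Poly d → Maybe R → Point d → Set
  Pκ κ α x = eval κ x ≤∞ α

module Submission where

open import Defs
open import Data.Fin using (Fin)
open import Data.Maybe using (Maybe; just; nothing)
open import Data.Nat using (ℕ)
open import Data.Product using (_×_; _,_)
open import Data.Unit using (tt)
open import Relation.Binary.PropositionalEquality using (subst₂) renaming (trans to trans-≡)
open import Algebra.Structures using (IsCommutativeRing)
open import Relation.Binary.Structures using (IsTotalOrder)

module OrderFacts (ℝ : RealField) where
  open RealField ℝ
  open IsTotalOrder isTotalOrder using (trans)
  open IsCommutativeRing isCommutativeRing using (+-comm; +-identityʳ)

  +-nonpos-≤ : ∀ w y → y ≤ 0# → w + y ≤ w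
  +-nonpos-≤ w y y≤0 =
    subst₂ _≤_ (+-comm y w) (trans-≡ (+-comm 0# w) (+-identityʳ w)) (+-mono-≤ y 0# w y≤0)

  ≤-bound-by-nonpos : ∀ x w y → x ≤ w + y → y ≤ 0# → x ≤ w
  ≤-bound-by-nonpos x w y x≤w+y y≤0 = trans x≤w+y (+-nonpos-≤ w y y≤0)

  ≤-≤∞-trans : ∀ {a b} (α : Maybe R) → a ≤ b → _≤∞_ ℝ b α → _≤∞_ ℝ a α
  ≤-≤∞-trans nothing  _   _   = tt
  ≤-≤∞-trans (just c) a≤b b≤c = trans a≤b b≤c

  Pκ-mono : ∀ {d} (κ : Poly ℝ d) {w} (α : Maybe R) → _≤∞_ ℝ w α →
            ∀ x → Pκ ℝ κ (just w) x → Pκ ℝ κ α x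
  Pκ-mono κ α w≤α x κx≤w = ≤-≤∞-trans α κx≤w w≤α

module SystemFacts (ℝ : RealField) {d : ℕ} (S : PPS ℝ d) where
  open RealField ℝ
  open PPS S
  open IsTotalOrder isTotalOrder using (trans)

  invariant⊇Reach : ∀ {C : Point ℝ d → Set} → IsInductiveInvariant ℝ S C →
                    ∀ x → Reach ℝ S x → C x
  invariant⊇Reach (C-init , _) x (init x∈Xin) = C-init x x∈Xin
  invariant⊇Reach inv@(_ , C-step) _ (step {x} i r x∈Xi x∈X0) =
    C-step i x (invariant⊇Reach inv x r) x∈Xi x∈X0

  sublevel-step : (V : Point ℝ d → R) →
    (∀ i x → _∈B_ ℝ x (X i) → _∈B_ ℝ x X0 → V (evalMap ℝ (T i) x) ≤ V x) →
    ∀ i x → V x ≤ 0# → _∈B_ ℝ x (X i) → _∈B_ ℝ x X0 → V (evalMap ℝ (T i) x) ≤ 0#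
  sublevel-step V decrease i x Vx≤0 x∈Xi x∈X0 = trans (decrease i x x∈Xi x∈X0) Vx≤0

  sublevel-invariant : (V : Point ℝ d → R) →
    (∀ x → _∈B_ ℝ x Xin → V x ≤ 0#) →
    (∀ i x → _∈B_ ℝ x (X i) → _∈B_ ℝ x X0 → V (evalMap ℝ (T i) x) ≤ V x) →
    IsInductiveInvariant ℝ S (λ x → V x ≤ 0#)
  sublevel-invariant V initial decrease = initial , sublevel-step V decrease

lemma1 : (ℝ : RealField) → {d : ℕ} → (S : PPS ℝ d) →
    (κ : Poly ℝ d) → (α : Maybe (RealField.R ℝ)) →
    (p : Poly ℝ d) → (w : RealField.R ℝ) →
    (∀ x → _∈B_ ℝ x (PPS.Xin S) → RealField._≤_ ℝ (eval ℝ p x) (RealField.0# ℝ)) →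
    (∀ (i : Fin (PPS.n S)) x → _∈B_ ℝ x (PPS.X S i) → _∈B_ ℝ x (PPS.X0 S) →
       RealField._≤_ ℝ (eval ℝ p (evalMap ℝ (PPS.T S i) x)) (eval ℝ p x)) →
    (∀ x → RealField._≤_ ℝ (eval ℝ κ x) (RealField._+_ ℝ w (eval ℝ p x))) →
    _≤∞_ ℝ w α →
    ((∀ x → _∈B_ ℝ x (PPS.Xin S) → RealField._≤_ ℝ (eval ℝ p x) (RealField.0# ℝ))
     × (∀ (i : Fin (PPS.n S)) x → RealField._≤_ ℝ (eval ℝ p x) (RealField.0# ℝ) →
          _∈B_ ℝ x (PPS.X S i) → _∈B_ ℝ x (PPS.X0 S) →
          RealField._≤_ ℝ (eval ℝ p (evalMap ℝ (PPS.T S i) x)) (RealField.0# ℝ))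
     × IsInductiveInvariant ℝ S (λ x → RealField._≤_ ℝ (eval ℝ p x) (RealField.0# ℝ)))
    × (∀ x → RealField._≤_ ℝ (eval ℝ p x) (RealField.0# ℝ) →
         RealField._≤_ ℝ (eval ℝ κ x) w × _≤∞_ ℝ w α)
    × ((∀ x → Reach ℝ S x → RealField._≤_ ℝ (eval ℝ p x) (RealField.0# ℝ))
       × (∀ x → RealField._≤_ ℝ (eval ℝ p x) (RealField.0# ℝ) → Pκ ℝ κ (just w) x)
       × (∀ x → Pκ ℝ κ (just w) x → Pκ ℝ κ α x))
lemma1 ℝ {d} S κ α p w p-init p-decrease κ≤w+p w≤α =
    (p-init , sublevel-step V p-decrease , P-invariant)
  , (λ x px≤0 → P⊆𝒫κw x px≤0 , w≤α)
  , (invariant⊇Reach P-invariant , P⊆𝒫κw , Pκ-mono κ α w≤α)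
  where
  open OrderFacts ℝ
  open SystemFacts ℝ S

  V : Point ℝ d → RealField.R ℝ
  V = eval ℝ p

  P-invariant : IsInductiveInvariant ℝ S (λ x → RealField._≤_ ℝ (V x) (RealField.0# ℝ))
  P-invariant = sublevel-invariant V p-init p-decrease

  P⊆𝒫κw : ∀ x → RealField._≤_ ℝ (V x) (RealField.0# ℝ) → Pκ ℝ κ (just w) x
  P⊆𝒫κw x px≤0 = ≤-bound-by-nonpos (eval ℝ κ x) w (V x) (κ≤w+p x) px≤0
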